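{- Let $T$ be a monad on $\mathbf{Set}$, $\mathcal{D}$ a complete category and $\bar\Omega=(\Omega_{\mathcal{D}},\tau)$ a $\mathcal{D}$-relative $T$-algebra. Then for every $D\in\mathcal{D}$ the underlying set of the $T$-algebra $[D,\bar\Omega]_{\mathcal{D}}$ is $\mathcal{D}(D,\Omega_{\mathcal{D}})$. Furthermore, suppose $V\colon\mathcal{D}\to\mathbf{Set}$ is a faithful functor preserving small limits, and let $\Omega_\tau=(\Omega,\hat\tau)=\bar V(\bar\Omega)$ be the underlying $T$-algebra. Then the map $\mathcal{D}(D,\Omega_{\mathcal{D}})\to\Omega^{VD}$, $k\mapsto Vk$, is an injective $T$-algebra homomorphism from $[D,\bar\Omega]_{\mathcal{D}}$ to the product $T$-algebra $\Omega_\tau^{VD}$ (whose structure is pointwise $\hat\tau$), so $[D,\bar\Omega]_{\mathcal{D}}$ is a $T$-subalgebra of $\Omega_\tau^{VD}$; and there is a natural isomorphism $V\circ[-,\bar\Omega]_T\cong\mathcal{E}\mathcal{M}(T)(-,\Omega_\tau)$ of functors $\mathcal{E}\mathcal{M}(T)^{\mathrm{op}}\to\mathbf{Set}$.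
   Context: For $A\in\mathcal{D}$ and a set $X$, $A^X$ is the $X$-fold product with projections $\pi_x$; for $g\colon X\to Y$, $g^*\colon A^Y\to A^X$ satisfies $\pi_x\circ g^*=\pi_{g(x)}$. The monad $\mathcal{D}(A^{(-)},A)$ on $\mathbf{Set}$: on $g$ it sends $k$ to $k\circ g^*$; unit $\eta_X(x)=\pi_x$; multiplication $\mu_X(\Xi)=\Xi\circ\langle\varphi\rangle_{\varphi}$. A $\mathcal{D}$-relative $T$-algebra is $(A,\alpha)$ with $\alpha\colon T\to\mathcal{D}(A^{(-)},A)$ a monad map; $\alpha^\sharp_X=\langle\alpha_X(t)\rangle_{t\in TX}\colon A^X\to A^{TX}$. $[D,\bar\Omega]_{\mathcal{D}}$ is the $T$-algebra on $\mathcal{D}(D,\Omega_{\mathcal{D}})$ with structure $(\mathrm{id}^\sharp)^*\circ\tau_{\mathcal{D}(D,\Omega_{\mathcal{D}})}$, where $\mathrm{id}^\sharp=\langle k\rangle_{k\in\mathcal{D}(D,\Omega_{\mathcal{D}})}\colon D\to\Omega_{\mathcal{D}}^{\mathcal{D}(D,\Omega_{\mathcal{D}})}$ and $(\mathrm{id}^\sharp)^*$ is precomposition. $[-,\bar\Omega]_T\colon\mathcal{E}\mathcal{M}(T)\to\mathcal{D}^{\mathrm{op}}$ sends a $T$-algebra $(A,a)$ to the equalizer of $a^*,\tau^\sharp_A\colon\Omega_{\mathcal{D}}^A\rightrightarrows\Omega_{\mathcal{D}}^{TA}$ and a morphism $f$ to the map of equalizers induced by $f^*$. $\bar V$ sends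 $(B,\beta)$ to the $T$-algebra on $VB$ with structure $t\mapsto V(\beta_{VB}(t))(\mathrm{id}_{VB})$, using $V(B^{VB})\cong(VB)^{VB}$. -}

module Defs where

open import Level using (Level; _⊔_) renaming (suc to lsuc; zero to lzero)
open import Data.Bool using (Bool; true; false)
open import Data.Unit using (⊤; tt)
open import Data.Empty using (⊥)
open import Data.Product using (Σ; _×_; _,_; proj₁; proj₂)
open import Function using (_∘′_)
open import Relation.Binary.PropositionalEquality
  using (_≡_; refl; sym; trans; cong; _≗_)

record Category (o : Level) : Set (lsuc o) where
  infixr 9 _∘_
  field
    Obj  : Set o
    Hom  : Obj → Obj → Set
    id   : ∀ {A} → Hom A A
    _∘_  : ∀ {A B C} → Hom B C → Hom A B → Hom A C
    idˡ  : ∀ {A B} (f : Hom A B) → id ∘ f ≡ f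
    idʳ  : ∀ {A B} (f : Hom A B) → f ∘ id ≡ f
    assoc : ∀ {A B C E} (h : Hom C E) (g : Hom B C) (f : Hom A B) →
            (h ∘ g) ∘ f ≡ h ∘ (g ∘ f)

-- small categories (indexing categories of small limits)
SmallCategory : Set₁
SmallCategory = Category lzero

record Functor {o p : Level} (J : Category o) (C : Category p) : Set (o ⊔ p) where
  private
    module J = Category J
    module C = Category C
  field
    F₀ : J.Obj → C.Obj
    F₁ : ∀ {i j} → J.Hom i j → C.Hom (F₀ i) (F₀ j)
    F-id : ∀ {i} → F₁ (J.id {i}) ≡ C.id
    F-∘  : ∀ {i j k} (g : J.Hom j k) (f : J.Hom i j) → F₁ (g J.∘ f) ≡ F₁ g C.∘ F₁ f

record SetFunctor {o : Level} (C : Category o) : Set (lsuc lzero ⊔ o) where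
  private module C = Category C
  field
    F₀ : C.Obj → Set
    F₁ : ∀ {A B} → C.Hom A B → F₀ A → F₀ B
    F-id : ∀ {A} → F₁ (C.id {A}) ≗ (λ x → x)
    F-∘  : ∀ {A B E} (g : C.Hom B E) (f : C.Hom A B) → F₁ (g C.∘ f) ≗ (F₁ g ∘′ F₁ f)

Faithful : ∀ {o} {C : Category o} → SetFunctor C → Set o
Faithful {C = C} V = ∀ {A B} (f g : Hom A B) → F₁ f ≗ F₁ g → f ≡ g
  where open Category C
        open SetFunctor V

module _ {o : Level} {C : Category o} where
  open Category C

  record Cone {J : SmallCategory} (F : Functor J C) : Set o where
    open Functor F
    field
      apex : Obj
      leg  : ∀ j → Hom apex (F₀ j)
      comm : ∀ {i j} (f : Category.Hom J i j) → F₁ f ∘ leg i ≡ leg j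

  IsLimit : {J : SmallCategory} {F : Functor J C} → Cone F → Set o
  IsLimit {J} {F} c =
    (c' : Cone F) →
      Σ (Hom (Cone.apex c') (Cone.apex c)) λ u →
        (∀ j → Cone.leg c j ∘ u ≡ Cone.leg c' j) ×
        (∀ u' → (∀ j → Cone.leg c j ∘ u' ≡ Cone.leg c' j) → u' ≡ u)

  record Limit {J : SmallCategory} (F : Functor J C) : Set o where
    field
      cone    : Cone F
      isLimit : IsLimit cone
    open Cone cone public

Complete : ∀ {o} → Category o → Set (lsuc lzero ⊔ o)
Complete C = (J : SmallCategory) (F : Functor J C) → Limit F

record SetCone {o : Level} {C : Category o} {J : SmallCategory}
               (V : SetFunctor C) (F : Functor J C) : Set₁ where
  open Functor F
  open SetFunctor V renaming (F₀ to V₀; F₁ to V₁)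
  field
    apex : Set
    leg  : ∀ j → apex → V₀ (F₀ j)
    comm : ∀ {i j} (f : Category.Hom J i j) → (V₁ (F₁ f) ∘′ leg i) ≗ leg j

IsSetLimit : ∀ {o} {C : Category o} {J : SmallCategory} {V : SetFunctor C}
             {F : Functor J C} → SetCone V F → Set₁
IsSetLimit {V = V} {F} c =
  (c' : SetCone V F) →
    Σ (SetCone.apex c' → SetCone.apex c) λ u →
      (∀ j → (SetCone.leg c j ∘′ u) ≗ SetCone.leg c' j) ×
      (∀ u' → (∀ j → (SetCone.leg c j ∘′ u') ≗ SetCone.leg c' j) → u' ≗ u)

mapCone : ∀ {o} {C : Category o} {J : SmallCategory} (V : SetFunctor C)
          {F : Functor J C} → Cone F → SetCone V F
mapCone {C = C} V {F} c = record
  { apex = V₀ (Cone.apex c)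
  ; leg  = λ j → V₁ (Cone.leg c j)
  ; comm = λ {i} {j} f x →
      trans (sym (F-∘ (Functor.F₁ F f) (Cone.leg c i) x))
            (cong (λ h → V₁ h x) (Cone.comm c f))
  }
  where open SetFunctor V renaming (F₀ to V₀; F₁ to V₁)

PreservesLimits : ∀ {o} {C : Category o} → SetFunctor C → Set (lsuc lzero ⊔ o)
PreservesLimits {C = C} V =
  (J : SmallCategory) (F : Functor J C) (c : Cone F) → IsLimit c →
  IsSetLimit (mapCone V c)

Discrete : Set → SmallCategory
Discrete X = record
  { Obj = X ; Hom = _≡_ ; id = refl ; _∘_ = λ g f → trans f g
  ; idˡ = λ f → rid f ; idʳ = λ _ → refl ; assoc = λ h g f → ass f g h }
  where
  rid : ∀ {x y : X} (f : x ≡ y) → trans f refl ≡ f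
  rid refl = refl
  ass : ∀ {x y z w : X} (f : x ≡ y) (g : y ≡ z) (h : z ≡ w) →
        trans f (trans g h) ≡ trans (trans f g) h
  ass refl refl refl = refl

data PPHom : Bool → Bool → Set where
  idS  : PPHom false false
  idT  : PPHom true true
  arr  : Bool → PPHom false true

ppComp : ∀ {a b c} → PPHom b c → PPHom a b → PPHom a c
ppComp idS f = f
ppComp idT f = f
ppComp (arr x) idS = arr x

ParallelPair : SmallCategory
ParallelPair = record
  { Obj = Bool ; Hom = PPHom ; id = λ {a} → ppid a ; _∘_ = ppComp
  ; idˡ = idl ; idʳ = idr ; assoc = as }
  where
  ppid : ∀ a → PPHom a a
  ppid false = idS
  ppid true  = idT
  idl : ∀ {a b} (f : PPHom a b) → ppComp (ppid b) f ≡ f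
  idl idS = refl
  idl idT = refl
  idl (arr x) = refl
  idr : ∀ {a b} (f : PPHom a b) → ppComp f (ppid a) ≡ f
  idr idS = refl
  idr idT = refl
  idr (arr x) = refl
  as : ∀ {a b c d} (h : PPHom c d) (g : PPHom b c) (f : PPHom a b) →
       ppComp (ppComp h g) f ≡ ppComp h (ppComp g f)
  as idS g f = refl
  as idT g f = refl
  as (arr x) idS f = refl

module Completeness {o : Level} (C : Category o) (cmp : Complete C) where
  open Category C

  ConstDiag : (X : Set) → Obj → Functor (Discrete X) C
  ConstDiag X A = record
    { F₀ = λ _ → A ; F₁ = λ _ → id ; F-id = refl ; F-∘ = λ _ _ → sym (idˡ id) }

  powerLimit : (A : Obj) (X : Set) → Limit (ConstDiag X A)
  powerLimit A X = cmp (Discrete X) (ConstDiag X A)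

  infixr 10 _^_
  _^_ : Obj → Set → Obj
  A ^ X = Limit.apex (powerLimit A X)

  π : ∀ {A X} → X → Hom (A ^ X) A
  π {A} {X} x = Limit.leg (powerLimit A X) x

  tuple : ∀ {A B} {X : Set} → (X → Hom B A) → Hom B (A ^ X)
  tuple {A} {B} {X} f = proj₁ (Limit.isLimit (powerLimit A X) c)
    where
    cm : ∀ {x y : X} (p : x ≡ y) → id ∘ f x ≡ f y
    cm refl = idˡ _
    c : Cone (ConstDiag X A)
    c = record { apex = B ; leg = f ; comm = cm }

  reindex : ∀ {A} {X Y : Set} → (X → Y) → Hom (A ^ Y) (A ^ X)
  reindex g = tuple (λ x → π (g x))

  PairDiag : ∀ {A B} → Hom A B → Hom A B → Functor ParallelPair C
  PairDiag {A} {B} f g = record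
    { F₀ = ob ; F₁ = mor ; F-id = λ {i} → fid i ; F-∘ = fcomp }
    where
    ob : Bool → Obj
    ob false = A
    ob true  = B
    mor : ∀ {i j} → PPHom i j → Hom (ob i) (ob j)
    mor idS = id
    mor idT = id
    mor (arr false) = f
    mor (arr true)  = g
    fid : ∀ i → mor (Category.id ParallelPair {i}) ≡ id
    fid false = refl
    fid true  = refl
    fcomp : ∀ {i j k} (h : PPHom j k) (e : PPHom i j) →
            mor (ppComp h e) ≡ mor h ∘ mor e
    fcomp idS e = sym (idˡ _)
    fcomp idT e = sym (idˡ _)
    fcomp (arr x) idS = sym (idʳ _)

  equalizerLimit : ∀ {A B} (f g : Hom A B) → Limit (PairDiag f g)
  equalizerLimit f g = cmp ParallelPair (PairDiag f g)

  Eq : ∀ {A B} → Hom A B → Hom A B → Obj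
  Eq f g = Limit.apex (equalizerLimit f g)

  eqMap : ∀ {A B} (f g : Hom A B) → Hom (Eq f g) A
  eqMap f g = Limit.leg (equalizerLimit f g) false

record Monad : Set₁ where
  field
    T      : Set → Set
    fmap   : ∀ {X Y} → (X → Y) → T X → T Y
    fmap-cong : ∀ {X Y} {f g : X → Y} → f ≗ g → fmap f ≗ fmap g
    fmap-id   : ∀ {X} → fmap {X} (λ x → x) ≗ (λ x → x)
    fmap-∘    : ∀ {X Y Z} (g : Y → Z) (f : X → Y) → fmap (g ∘′ f) ≗ (fmap g ∘′ fmap f)
    η      : ∀ {X} → X → T X
    μ      : ∀ {X} → T (T X) → T X
    η-nat  : ∀ {X Y} (f : X → Y) → (fmap f ∘′ η) ≗ (η ∘′ f)
    μ-nat  : ∀ {X Y} (f : X → Y) → (fmap f ∘′ μ) ≗ (μ ∘′ fmap (fmap f))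
    μ∘η    : ∀ {X} → (μ {X} ∘′ η) ≗ (λ t → t)
    μ∘Tη   : ∀ {X} → (μ {X} ∘′ fmap η) ≗ (λ t → t)
    μ∘μ    : ∀ {X} → (μ {X} ∘′ μ) ≗ (μ ∘′ fmap μ)

module _ (M : Monad) where
  open Monad M

  IsEMAlgebra : (A : Set) → (T A → A) → Set
  IsEMAlgebra A a = ((a ∘′ η) ≗ (λ x → x)) × ((a ∘′ μ) ≗ (a ∘′ fmap a))

  record EMAlgebra : Set₁ where
    field
      Carrier : Set
      str     : T Carrier → Carrier
      isEM    : IsEMAlgebra Carrier str

  IsHom : {A B : Set} → (T A → A) → (T B → B) → (A → B) → Set
  IsHom a b f = ∀ t → f (a t) ≡ b (fmap f t)

  EMHom : EMAlgebra → EMAlgebra → Set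
  EMHom A B = Σ (EMAlgebra.Carrier A → EMAlgebra.Carrier B)
                (IsHom (EMAlgebra.str A) (EMAlgebra.str B))

  HomInto : EMAlgebra → (B : Set) → (T B → B) → Set
  HomInto A B b = Σ (EMAlgebra.Carrier A → B) (IsHom (EMAlgebra.str A) b)

module Relative (M : Monad) {o : Level} (C : Category o) (cmp : Complete C) where
  open Monad M
  open Category C
  open Completeness C cmp

  -- the monad C(A^(-),A):  X ↦ Hom (A ^ X) A
  S-fmap : ∀ {A} {X Y : Set} → (X → Y) → Hom (A ^ X) A → Hom (A ^ Y) A
  S-fmap g k = k ∘ reindex g

  S-η : ∀ {A} {X : Set} → X → Hom (A ^ X) A
  S-η x = π x

  S-μ : ∀ {A} {X : Set} → Hom (A ^ Hom (A ^ X) A) A → Hom (A ^ X) A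
  S-μ Ξ = Ξ ∘ tuple (λ φ → φ)

  -- a C-relative T-algebra: a monad morphism α : T → C(A^(-),A)
  record RelAlgebra (A : Obj) : Set₁ where
    field
      α     : ∀ {X : Set} → T X → Hom (A ^ X) A
      α-nat : ∀ {X Y : Set} (g : X → Y) (t : T X) → α (fmap g t) ≡ S-fmap g (α t)
      α-η   : ∀ {X : Set} (x : X) → α (η x) ≡ S-η x
      α-μ   : ∀ {X : Set} (t : T (T X)) →
              α (μ t) ≡ S-μ (S-fmap (α {X}) (α {T X} t))

    α♯ : ∀ {X : Set} → Hom (A ^ X) (A ^ T X)
    α♯ = tuple (λ t → α t)

  module _ {Ω : Obj} (τ : RelAlgebra Ω) where
    open RelAlgebra τ

    -- structure map of [D, Ω̄]_C on the set Hom D Ω:  t ↦ τ(t) ∘ id♯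
    homStr : (D : Obj) → T (Hom D Ω) → Hom D Ω
    homStr D t = α t ∘ tuple (λ k → k)

    -- [A, Ω̄]_T : equalizer of a* and τ♯_A
    eqObj : EMAlgebra M → Obj
    eqObj A = Eq (reindex {Ω} (EMAlgebra.str A)) (α♯ {EMAlgebra.Carrier A})

    eqIncl : (A : EMAlgebra M) → Hom (eqObj A) (Ω ^ EMAlgebra.Carrier A)
    eqIncl A = eqMap (reindex {Ω} (EMAlgebra.str A)) (α♯ {EMAlgebra.Carrier A})

    -- m is the map of equalizers [B,Ω̄]_T → [A,Ω̄]_T induced by f*
    -- (i.e. the unique m with e_A ∘ m ≡ f* ∘ e_B)
    InducedBy : (A B : EMAlgebra M) → EMHom M A B → Hom (eqObj B) (eqObj A) → Set
    InducedBy A B f m = eqIncl A ∘ m ≡ reindex (proj₁ f) ∘ eqIncl B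

    module _ (V : SetFunctor C) (pres : PreservesLimits V) where
      open SetFunctor V renaming (F₀ to V₀; F₁ to V₁)

      -- the element of V(B^{VB}) corresponding to id ∈ (VB)^{VB}
      -- under V(B^{VB}) ≅ (VB)^{VB}
      idElt : (B : Obj) → V₀ (B ^ V₀ B)
      idElt B = proj₁ (pres (Discrete (V₀ B)) (ConstDiag (V₀ B) B)
                        (Limit.cone (powerLimit B (V₀ B)))
                        (Limit.isLimit (powerLimit B (V₀ B))) c) tt
        where
        cm : ∀ {x y : V₀ B} (p : x ≡ y) → (λ (_ : ⊤) → V₁ id x) ≗ (λ _ → y)
        cm {x} refl _ = F-id x
        c : SetCone V (ConstDiag (V₀ B) B)
        c = record { apex = ⊤ ; leg = λ x _ → x ; comm = cm }

      -- Ω_τ = V̄(Ω̄) : the underlying T-algebra structure on V Ω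
      τ̂ : T (V₀ Ω) → V₀ Ω
      τ̂ t = V₁ (α t) (idElt Ω)

      powStr : (X : Set) → T (X → V₀ Ω) → (X → V₀ Ω)
      powStr X t x = τ̂ (fmap (λ f → f x) t)

      record NatIso : Set₁ where
        field
          φ : (A : EMAlgebra M) → V₀ (eqObj A) → HomInto M A (V₀ Ω) τ̂
          ψ : (A : EMAlgebra M) → HomInto M A (V₀ Ω) τ̂ → V₀ (eqObj A)
          ψ-cong : (A : EMAlgebra M) (h h' : HomInto M A (V₀ Ω) τ̂) →
                   proj₁ h ≗ proj₁ h' → ψ A h ≡ ψ A h'
          ψφ : (A : EMAlgebra M) (x : V₀ (eqObj A)) → ψ A (φ A x) ≡ x
          φψ : (A : EMAlgebra M) (h : HomInto M A (V₀ Ω) τ̂) →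
               proj₁ (φ A (ψ A h)) ≗ proj₁ h
          natural : (A B : EMAlgebra M) (f : EMHom M A B)
                    (m : Hom (eqObj B) (eqObj A)) → InducedBy A B f m →
                    (x : V₀ (eqObj B)) →
                    proj₁ (φ A (V₁ m x)) ≗ (proj₁ (φ B x) ∘′ proj₁ f)

module Submission where

-- Next, for a limit-preserving V, the legs of V(lim F) are jointly injective;
-- on powers this gives the coordinate bijection V(A^X) ≅ (VA)^X (elementOf),
-- and on equalizers V(Eq f g) ≅ {w | V f w = V g w} (eqLift, eqMap-injective).
-- The T-algebra axioms for [D,Ω̄] then follow from the monad-morphism laws of
-- τ together with the identity reindex g ∘ ⟨f⟩ = ⟨f ∘ g⟩.  The underlying
-- structure τ̂ acts on coordinates as V(τ t), which yields the homomorphism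
-- property of k ↦ V k and shows that an element of V(Ω^A) lies in the
-- equalizer [A,Ω̄]_T exactly when its coordinate function is a T-algebra map
-- A → Ω_τ: this is the natural isomorphism.  Injectivity is faithfulness.

open import Defs
open import Level using (Level)
open import Data.Product using (_×_; _,_; proj₁; proj₂)
open import Data.Bool using (Bool; true; false)
open import Data.Unit using (⊤; tt)
open import Relation.Binary.PropositionalEquality
  using (_≡_; _≗_; refl; sym; trans; cong; module ≡-Reasoning)
open import Function using (_∘′_)

module LimitLemmas {o : Level} (C : Category o) where
  open Category C

  mediator : ∀ {J} {F : Functor J C} (L : Limit F) (c : Cone F) →
             Hom (Cone.apex c) (Limit.apex L)
  mediator L c = proj₁ (Limit.isLimit L c)

  mediator-β : ∀ {J} {F : Functor J C} (L : Limit F) (c : Cone F) j →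
               Limit.leg L j ∘ mediator L c ≡ Cone.leg c j
  mediator-β L c = proj₁ (proj₂ (Limit.isLimit L c))

  legs-jointly-monic : ∀ {J} {F : Functor J C} (L : Limit F) {B}
                       {u v : Hom B (Limit.apex L)} →
                       (∀ j → Limit.leg L j ∘ u ≡ Limit.leg L j ∘ v) → u ≡ v
  legs-jointly-monic {F = F} L {B} {u} {v} agree =
    trans (unique u agree) (sym (unique v (λ _ → refl)))
    where
    -- the cone (leg j ∘ v)_j, through which both u and v factor
    restricted : Cone F
    restricted = record
      { apex = B
      ; leg  = λ j → Limit.leg L j ∘ v
      ; comm = λ f → trans (sym (assoc _ _ v)) (cong (_∘ v) (Limit.comm L f)) }
    unique : ∀ w → (∀ j → Limit.leg L j ∘ w ≡ Limit.leg L j ∘ v) →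
             w ≡ mediator L restricted
    unique = proj₂ (proj₂ (Limit.isLimit L restricted))

module PowerLemmas {o : Level} (C : Category o) (cmp : Complete C) where
  open Category C
  open Completeness C cmp
  open LimitLemmas C
  open ≡-Reasoning

  tuple-β : ∀ {A B} {X : Set} (f : X → Hom B A) (x : X) → π x ∘ tuple f ≡ f x
  tuple-β {A} {X = X} f = mediator-β (powerLimit A X) _

  reindex-β : ∀ {A} {X Y : Set} (g : X → Y) (x : X) →
              π {A} x ∘ reindex g ≡ π (g x)
  reindex-β g = tuple-β (λ x → π (g x))

  power-ext : ∀ {A B} {X : Set} {u v : Hom B (A ^ X)} →
              (∀ x → π x ∘ u ≡ π x ∘ v) → u ≡ v
  power-ext {A} {X = X} = legs-jointly-monic (powerLimit A X)

  tuple-natural : ∀ {A B E} {X : Set} (f : X → Hom B A) (u : Hom E B) →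
                  tuple f ∘ u ≡ tuple (λ x → f x ∘ u)
  tuple-natural f u = power-ext λ x → begin
    π x ∘ (tuple f ∘ u)            ≡⟨ sym (assoc _ _ _) ⟩
    (π x ∘ tuple f) ∘ u            ≡⟨ cong (_∘ u) (tuple-β f x) ⟩
    f x ∘ u                        ≡⟨ sym (tuple-β _ x) ⟩
    π x ∘ tuple (λ x′ → f x′ ∘ u)  ∎

  reindex-tuple : ∀ {A B} {X Y : Set} (g : X → Y) (f : Y → Hom B A) →
                  reindex g ∘ tuple f ≡ tuple (f ∘′ g)
  reindex-tuple g f = power-ext λ x → begin
    π x ∘ (reindex g ∘ tuple f)  ≡⟨ sym (assoc _ _ _) ⟩
    (π x ∘ reindex g) ∘ tuple f  ≡⟨ cong (_∘ tuple f) (reindex-β g x) ⟩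
    π (g x) ∘ tuple f            ≡⟨ tuple-β f (g x) ⟩
    f (g x)                      ≡⟨ sym (tuple-β _ x) ⟩
    π x ∘ tuple (f ∘′ g)         ∎

  eqMap-equalizes : ∀ {A B} (f g : Hom A B) → f ∘ eqMap f g ≡ g ∘ eqMap f g
  eqMap-equalizes f g =
    trans (Limit.comm L (arr false)) (sym (Limit.comm L (arr true)))
    where
    L : Limit (PairDiag f g)
    L = equalizerLimit f g

module PreservedLimitLemmas {o : Level} {C : Category o}
  (V : SetFunctor C) (pres : PreservesLimits V) where
  open Category C
  open SetFunctor V renaming (F₀ to V₀; F₁ to V₁)

  V-∘ : ∀ {A B E} (g : Hom B E) (f : Hom A B) x → V₁ g (V₁ f x) ≡ V₁ (g ∘ f) x
  V-∘ g f x = sym (F-∘ g f x)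

  V-≡ : ∀ {A B} {g g′ : Hom A B} x → g ≡ g′ → V₁ g x ≡ V₁ g′ x
  V-≡ x refl = refl

  image-mediator : ∀ {J} {F : Functor J C} (L : Limit F) (c : SetCone V F) →
                   SetCone.apex c → V₀ (Limit.apex L)
  image-mediator {J} {F} L c = proj₁ (pres J F (Limit.cone L) (Limit.isLimit L) c)

  image-β : ∀ {J} {F : Functor J C} (L : Limit F) (c : SetCone V F) j a →
            V₁ (Limit.leg L j) (image-mediator L c a) ≡ SetCone.leg c j a
  image-β {J} {F} L c =
    proj₁ (proj₂ (pres J F (Limit.cone L) (Limit.isLimit L) c))

  image-legs-jointly-injective :
    ∀ {J} {F : Functor J C} (L : Limit F) {x x′ : V₀ (Limit.apex L)} →
    (∀ j → V₁ (Limit.leg L j) x ≡ V₁ (Limit.leg L j) x′) → x ≡ x′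
  image-legs-jointly-injective {J} {F} L {x} {x′} agree =
    trans (unique (λ _ → x) (λ _ _ → refl) tt)
          (sym (unique (λ _ → x′) (λ j _ → sym (agree j)) tt))
    where
    point : SetCone V F
    point = record
      { apex = ⊤
      ; leg  = λ j _ → V₁ (Limit.leg L j) x
      ; comm = λ f _ → SetCone.comm (mapCone V (Limit.cone L)) f x }
    unique : ∀ u → (∀ j → (V₁ (Limit.leg L j) ∘′ u) ≗ SetCone.leg point j) →
             u ≗ image-mediator L point
    unique = proj₂ (proj₂ (pres J F (Limit.cone L) (Limit.isLimit L) point))

module PreservedPowerLemmas {o : Level} (C : Category o) (cmp : Complete C)
  (V : SetFunctor C) (pres : PreservesLimits V) where
  open Category C
  open Completeness C cmp
  open PowerLemmas C cmp
  open PreservedLimitLemmas V pres public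
  open SetFunctor V renaming (F₀ to V₀; F₁ to V₁)
  open ≡-Reasoning

  coords : ∀ {A} {X : Set} → V₀ (A ^ X) → X → V₀ A
  coords w x = V₁ (π x) w

  elementOf : ∀ {A} {X : Set} → (X → V₀ A) → V₀ (A ^ X)
  elementOf {A} {X} h = image-mediator (powerLimit A X) family tt
    where
    respects : ∀ {x y : X} (p : x ≡ y) → (λ (_ : ⊤) → V₁ id (h x)) ≗ (λ _ → h y)
    respects refl _ = F-id _
    family : SetCone V (ConstDiag X A)
    family = record { apex = ⊤ ; leg = λ x _ → h x ; comm = respects }

  elementOf-β : ∀ {A} {X : Set} (h : X → V₀ A) (x : X) → coords (elementOf h) x ≡ h x
  elementOf-β {A} {X} h x = image-β (powerLimit A X) _ x tt

  element-ext : ∀ {A} {X : Set} {w w′ : V₀ (A ^ X)} →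
                (∀ x → coords w x ≡ coords w′ x) → w ≡ w′
  element-ext {A} {X} = image-legs-jointly-injective (powerLimit A X)

  elementOf-cong : ∀ {A} {X : Set} {h h′ : X → V₀ A} → h ≗ h′ →
                   elementOf h ≡ elementOf h′
  elementOf-cong {h = h} {h′} h≗h′ = element-ext λ x →
    trans (elementOf-β h x) (trans (h≗h′ x) (sym (elementOf-β h′ x)))

  elementOf-coords : ∀ {A} {X : Set} (w : V₀ (A ^ X)) → elementOf (coords w) ≡ w
  elementOf-coords w = element-ext (elementOf-β (coords w))

  coords-tuple : ∀ {A B} {X : Set} (f : X → Hom B A) (b : V₀ B) (x : X) →
                 coords (V₁ (tuple f) b) x ≡ V₁ (f x) b
  coords-tuple f b x = trans (V-∘ _ _ b) (V-≡ b (tuple-β f x))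

  coords-reindex : ∀ {A} {X Y : Set} (g : X → Y) (w : V₀ (A ^ Y)) (x : X) →
                   coords (V₁ (reindex g) w) x ≡ coords w (g x)
  coords-reindex g = coords-tuple (λ x → π (g x))

  V-tuple : ∀ {A B} {X : Set} (f : X → Hom B A) (b : V₀ B) →
            V₁ (tuple f) b ≡ elementOf (λ x → V₁ (f x) b)
  V-tuple f b = element-ext λ x →
    trans (coords-tuple f b x) (sym (elementOf-β (λ x′ → V₁ (f x′) b) x))

  eqLift : ∀ {A B} (f g : Hom A B) (w : V₀ A) → V₁ f w ≡ V₁ g w → V₀ (Eq f g)
  eqLift {A} {B} f g w fw≡gw = image-mediator (equalizerLimit f g) fork tt
    where
    leg : (j : Bool) → ⊤ → V₀ (Functor.F₀ (PairDiag f g) j)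
    leg false _ = w
    leg true  _ = V₁ f w
    commutes : ∀ {i j} (e : PPHom i j) →
               (V₁ (Functor.F₁ (PairDiag f g) e) ∘′ leg i) ≗ leg j
    commutes idS _ = F-id w
    commutes idT _ = F-id (V₁ f w)
    commutes (arr false) _ = refl
    commutes (arr true)  _ = sym fw≡gw
    fork : SetCone V (PairDiag f g)
    fork = record { apex = ⊤ ; leg = leg ; comm = commutes }

  eqLift-β : ∀ {A B} (f g : Hom A B) (w : V₀ A) (e : V₁ f w ≡ V₁ g w) →
             V₁ (eqMap f g) (eqLift f g w e) ≡ w
  eqLift-β f g w e = image-β (equalizerLimit f g) _ false tt

  V-eqMap-equalizes : ∀ {A B} (f g : Hom A B) (x : V₀ (Eq f g)) →
                      V₁ f (V₁ (eqMap f g) x) ≡ V₁ g (V₁ (eqMap f g) x)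
  V-eqMap-equalizes f g x =
    trans (V-∘ _ _ x) (trans (V-≡ x (eqMap-equalizes f g)) (sym (V-∘ _ _ x)))

  eqMap-injective : ∀ {A B} (f g : Hom A B) {x x′ : V₀ (Eq f g)} →
                    V₁ (eqMap f g) x ≡ V₁ (eqMap f g) x′ → x ≡ x′
  eqMap-injective f g {x} {x′} same = image-legs-jointly-injective L agree
    where
    L : Limit (PairDiag f g)
    L = equalizerLimit f g
    -- the leg at the codomain is f ∘ eqMap, so it is determined by eqMap
    agree : ∀ j → V₁ (Limit.leg L j) x ≡ V₁ (Limit.leg L j) x′
    agree false = same
    agree true = begin
      V₁ (Limit.leg L true) x    ≡⟨ V-≡ x (sym (Limit.comm L (arr false))) ⟩
      V₁ (f ∘ eqMap f g) x       ≡⟨ sym (V-∘ _ _ x) ⟩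
      V₁ f (V₁ (eqMap f g) x)    ≡⟨ cong (V₁ f) same ⟩
      V₁ f (V₁ (eqMap f g) x′)   ≡⟨ V-∘ _ _ x′ ⟩
      V₁ (f ∘ eqMap f g) x′      ≡⟨ V-≡ x′ (Limit.comm L (arr false)) ⟩
      V₁ (Limit.leg L true) x′   ∎

module RelativeAlgebraLemmas (M : Monad) {o : Level} (C : Category o)
  (cmp : Complete C) {Ω : Category.Obj C} (τ : Relative.RelAlgebra M C cmp Ω) where
  open Monad M
  open Category C
  open Completeness C cmp
  open PowerLemmas C cmp
  open Relative M C cmp
  open RelAlgebra τ
  open ≡-Reasoning

  homStr-isEM : (D : Obj) → IsEMAlgebra M (Hom D Ω) (homStr τ D)
  homStr-isEM D = unit-law , mult-law
    where
    ι : Hom D (Ω ^ Hom D Ω)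
    ι = tuple (λ k → k)
    str : T (Hom D Ω) → Hom D Ω
    str = homStr τ D
    unit-law : ∀ k → str (η k) ≡ k
    unit-law k = trans (cong (_∘ ι) (α-η k)) (tuple-β _ k)
    mult-law : ∀ t → str (μ t) ≡ str (fmap str t)
    mult-law t = begin
      α (μ t) ∘ ι                                  ≡⟨ cong (_∘ ι) (α-μ t) ⟩
      ((α t ∘ reindex α) ∘ tuple (λ φ → φ)) ∘ ι    ≡⟨ trans (assoc _ _ _) (assoc _ _ _) ⟩
      α t ∘ (reindex α ∘ (tuple (λ φ → φ) ∘ ι))    ≡⟨ cong (α t ∘_) (sym (assoc _ _ _)) ⟩
      α t ∘ ((reindex α ∘ tuple (λ φ → φ)) ∘ ι)    ≡⟨ cong (λ u → α t ∘ (u ∘ ι)) (reindex-tuple α (λ φ → φ)) ⟩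
      α t ∘ (tuple α ∘ ι)                          ≡⟨ cong (α t ∘_) (tuple-natural α ι) ⟩
      α t ∘ tuple str                              ≡⟨ cong (α t ∘_) (sym (reindex-tuple str (λ k → k))) ⟩
      α t ∘ (reindex str ∘ ι)                      ≡⟨ sym (assoc _ _ _) ⟩
      (α t ∘ reindex str) ∘ ι                      ≡⟨ cong (_∘ ι) (sym (α-nat str t)) ⟩
      α (fmap str t) ∘ ι                           ∎

  module Underlying (V : SetFunctor C) (pres : PreservesLimits V) where
    open SetFunctor V renaming (F₀ to V₀; F₁ to V₁)
    open PreservedPowerLemmas C cmp V pres

    τ̂′ : T (V₀ Ω) → V₀ Ω
    τ̂′ = τ̂ τ V pres

    idElt-β : ∀ {B} (x : V₀ B) → coords (idElt τ V pres B) x ≡ x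
    idElt-β {B} x = image-β (powerLimit B (V₀ B)) _ x tt

    τ̂-fmap : ∀ {X : Set} (h : X → V₀ Ω) (t : T X) →
             τ̂′ (fmap h t) ≡ V₁ (α t) (elementOf h)
    τ̂-fmap h t = begin
      V₁ (α (fmap h t)) iΩ            ≡⟨ V-≡ iΩ (α-nat h t) ⟩
      V₁ (α t ∘ reindex h) iΩ         ≡⟨ sym (V-∘ _ _ iΩ) ⟩
      V₁ (α t) (V₁ (reindex h) iΩ)    ≡⟨ cong (V₁ (α t)) reindex-idElt ⟩
      V₁ (α t) (elementOf h)          ∎
      where
      iΩ : V₀ (Ω ^ V₀ Ω)
      iΩ = idElt τ V pres Ω
      reindex-idElt : V₁ (reindex h) iΩ ≡ elementOf h
      reindex-idElt = element-ext λ x →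
        trans (coords-reindex h iΩ x)
              (trans (idElt-β (h x)) (sym (elementOf-β h x)))

    τ̂-coords : ∀ {X : Set} (t : T X) (w : V₀ (Ω ^ X)) →
               V₁ (α t) w ≡ τ̂′ (fmap (coords w) t)
    τ̂-coords t w = trans (cong (V₁ (α t)) (sym (elementOf-coords w)))
                         (sym (τ̂-fmap (coords w) t))

    V-isHom : (D : Obj) (t : T (Hom D Ω)) (d : V₀ D) →
              V₁ (homStr τ D t) d ≡ powStr τ V pres (V₀ D) (fmap V₁ t) d
    V-isHom D t d = begin
      V₁ (α t ∘ tuple (λ k → k)) d                 ≡⟨ sym (V-∘ _ _ d) ⟩
      V₁ (α t) (V₁ (tuple (λ k → k)) d)            ≡⟨ cong (V₁ (α t)) (V-tuple (λ k → k) d) ⟩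
      V₁ (α t) (elementOf (λ k → V₁ k d))          ≡⟨ sym (τ̂-fmap (λ k → V₁ k d) t) ⟩
      τ̂′ (fmap (λ k → V₁ k d) t)                   ≡⟨ cong τ̂′ (fmap-∘ (λ f → f d) V₁ t) ⟩
      τ̂′ (fmap (λ f → f d) (fmap V₁ t))            ∎

    module _ (A : EMAlgebra M) where
      open EMAlgebra A renaming (Carrier to Car; str to a)

      equalizing⇒hom : (w : V₀ (Ω ^ Car)) →
                       V₁ (reindex a) w ≡ V₁ (α♯ {Car}) w → IsHom M a τ̂′ (coords w)
      equalizing⇒hom w equal t = begin
        coords w (a t)                    ≡⟨ sym (coords-reindex a w t) ⟩
        coords (V₁ (reindex a) w) t       ≡⟨ cong (λ v → coords v t) equal ⟩
        coords (V₁ α♯ w) t                ≡⟨ coords-tuple α w t ⟩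
        V₁ (α t) w                        ≡⟨ τ̂-coords t w ⟩
        τ̂′ (fmap (coords w) t)            ∎

      hom⇒equalizing : (h : Car → V₀ Ω) → IsHom M a τ̂′ h →
                       V₁ (reindex a) (elementOf h) ≡ V₁ (α♯ {Car}) (elementOf h)
      hom⇒equalizing h isHom = element-ext λ t → begin
        coords (V₁ (reindex a) (elementOf h)) t  ≡⟨ coords-reindex a _ t ⟩
        coords (elementOf h) (a t)               ≡⟨ elementOf-β h (a t) ⟩
        h (a t)                                  ≡⟨ isHom t ⟩
        τ̂′ (fmap h t)                            ≡⟨ τ̂-fmap h t ⟩
        V₁ (α t) (elementOf h)                   ≡⟨ sym (coords-tuple α _ t) ⟩
        coords (V₁ α♯ (elementOf h)) t           ∎

      toHom : V₀ (eqObj τ A) → HomInto M A (V₀ Ω) τ̂′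
      toHom x = coords (V₁ (eqIncl τ A) x)
              , equalizing⇒hom _ (V-eqMap-equalizes (reindex a) α♯ x)

      fromHom : HomInto M A (V₀ Ω) τ̂′ → V₀ (eqObj τ A)
      fromHom (h , isHom) = eqLift (reindex a) α♯ (elementOf h) (hom⇒equalizing h isHom)

      incl-fromHom : ∀ h → V₁ (eqIncl τ A) (fromHom h) ≡ elementOf (proj₁ h)
      incl-fromHom (h , isHom) = eqLift-β (reindex a) α♯ _ (hom⇒equalizing h isHom)

      fromHom-cong : (h h′ : HomInto M A (V₀ Ω) τ̂′) → proj₁ h ≗ proj₁ h′ →
                     fromHom h ≡ fromHom h′
      fromHom-cong h h′ h≗h′ = eqMap-injective (reindex a) α♯
        (trans (incl-fromHom h)
               (trans (elementOf-cong h≗h′) (sym (incl-fromHom h′))))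

      fromHom-toHom : (x : V₀ (eqObj τ A)) → fromHom (toHom x) ≡ x
      fromHom-toHom x = eqMap-injective (reindex a) α♯
        (trans (incl-fromHom (toHom x)) (elementOf-coords _))

      toHom-fromHom : (h : HomInto M A (V₀ Ω) τ̂′) →
                      proj₁ (toHom (fromHom h)) ≗ proj₁ h
      toHom-fromHom h x =
        trans (cong (λ v → coords v x) (incl-fromHom h)) (elementOf-β (proj₁ h) x)

    toHom-natural : (A B : EMAlgebra M) (f : EMHom M A B)
                    (m : Hom (eqObj τ B) (eqObj τ A)) → InducedBy τ A B f m →
                    (x : V₀ (eqObj τ B)) →
                    proj₁ (toHom A (V₁ m x)) ≗ (proj₁ (toHom B x) ∘′ proj₁ f)
    toHom-natural A B f m induced x c = begin
      coords (V₁ (eqIncl τ A) (V₁ m x)) c                 ≡⟨ cong (λ v → coords v c) incl-m ⟩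
      coords (V₁ (reindex (proj₁ f)) (V₁ (eqIncl τ B) x)) c  ≡⟨ coords-reindex (proj₁ f) _ c ⟩
      coords (V₁ (eqIncl τ B) x) (proj₁ f c)              ∎
      where
      incl-m : V₁ (eqIncl τ A) (V₁ m x) ≡ V₁ (reindex (proj₁ f)) (V₁ (eqIncl τ B) x)
      incl-m = trans (V-∘ _ _ x) (trans (V-≡ x induced) (sym (V-∘ _ _ x)))

    natIso : NatIso τ V pres
    natIso = record
      { φ = toHom ; ψ = fromHom ; ψ-cong = fromHom-cong
      ; ψφ = fromHom-toHom ; φψ = toHom-fromHom ; natural = toHom-natural }

proposition4p14 :
    (M : Monad) {o : Level} (C : Category o) (cmp : Complete C)
    (Ω : Category.Obj C) (τ : Relative.RelAlgebra M C cmp Ω) →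
    ((D : Category.Obj C) →
       IsEMAlgebra M (Category.Hom C D Ω) (Relative.homStr M C cmp τ D))
    ×
    ((V : SetFunctor C) → Faithful V → (pres : PreservesLimits V) →
       ((D : Category.Obj C) →
          ((k k' : Category.Hom C D Ω) →
             SetFunctor.F₁ V k ≗ SetFunctor.F₁ V k' → k ≡ k')
          ×
          ((t : Monad.T M (Category.Hom C D Ω)) (d : SetFunctor.F₀ V D) →
             SetFunctor.F₁ V (Relative.homStr M C cmp τ D t) d
             ≡ Relative.powStr M C cmp τ V pres (SetFunctor.F₀ V D)
                 (Monad.fmap M (SetFunctor.F₁ V) t) d))
       ×
       Relative.NatIso M C cmp τ V pres)
proposition4p14 M C cmp Ω τ =
  homStr-isEM ,
  -- injectivity of k ↦ V k is exactly faithfulness of V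
  λ V faithful pres →
    let open Underlying V pres in
    (λ D → faithful , V-isHom D) , natIso
  where open RelativeAlgebraLemmas M C cmp τ
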